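{- For any graph $G$ of order $n$ and any nonempty graph $H$, $$\gamma_{\rm sp}(G\odot H)=n(\gamma_{\rm sp}(H)+1).$$ Furthermore, for any integer $r\ge 1$, $$\gamma_{\rm sp}(G\odot N_r)=nr.$$
   Context: All graphs are finite, simple and undirected. A graph is nonempty if it has at least one edge; $N_r$ denotes the graph with $r$ vertices and no edges. For a vertex $v$, $N(v)$ is its set of neighbours; for $D\subseteq V(G)$, $\overline{D}=V(G)\setminus D$. A set $D\subseteq V(G)$ is a super dominating set of $G$ if for every $u\in\overline{D}$ there exists $v\in D$ such that $N(v)\cap\overline{D}=\{u\}$; the super domination number $\gamma_{\rm sp}(G)$ is the minimum cardinality of a super dominating set of $G$. The corona product $G\odot H$ is obtained by taking one copy of $G$ and $|V(G)|$ copies of $H$, and joining by an edge each vertex of the $i$-th copy of $H$ to the $i$-th vertex of $G$. -}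

module Defs where

open import Data.Nat using (ℕ; _+_; _*_; _≤_)
open import Data.Bool using (Bool; true; false; _∧_; T)
open import Data.Fin using (Fin; splitAt; remQuot)
open import Data.Fin.Properties using (_≟_)
open import Data.Fin.Subset using (Subset; _∈_; _∉_; ∣_∣)
open import Data.Sum using (_⊎_; inj₁; inj₂)
open import Data.Product using (_×_; _,_; Σ; ∃)
open import Relation.Nullary using (¬_; does)
open import Relation.Binary.PropositionalEquality using (_≡_)

Graph : ℕ → Set
Graph n = Fin n → Fin n → Bool

Adj : ∀ {n} → Graph n → Fin n → Fin n → Set
Adj G u v = T (G u v)

IsSimple : ∀ {n} → Graph n → Set
IsSimple {n} G = (∀ u v → G u v ≡ G v u) × (∀ u → G u u ≡ false)

Nonempty : ∀ {n} → Graph n → Set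
Nonempty {n} G = Σ (Fin n) λ u → Σ (Fin n) λ v → Adj G u v

N : (r : ℕ) → Graph r
N r _ _ = false

IsSuperDominating : ∀ {n} → Graph n → Subset n → Set
IsSuperDominating {n} G D =
  ∀ u → u ∉ D →
    Σ (Fin n) λ v → v ∈ D × Adj G v u × (∀ w → w ∉ D → Adj G v w → w ≡ u)

-- γ_sp(G) = k : k is the minimum cardinality of a super dominating set
-- (V(G) itself is always super dominating, so the minimum exists).
IsSuperDominationNumber : ∀ {n} → Graph n → ℕ → Set
IsSuperDominationNumber {n} G k =
  (Σ (Subset n) λ D → IsSuperDominating G D × ∣ D ∣ ≡ k)
  × (∀ D → IsSuperDominating G D → k ≤ ∣ D ∣)

-- Vertices of G ⊙ H are Fin (n + n * m): the first n are the vertices of G,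
-- the remaining n * m encode pairs (i , a) = vertex a of the i-th copy of H.
CVert : ℕ → ℕ → Set
CVert n m = Fin n ⊎ (Fin n × Fin m)

view : ∀ n m → Fin (n + n * m) → CVert n m
view n m x with splitAt n x
... | inj₁ i = inj₁ i
... | inj₂ y = inj₂ (remQuot m y)

coronaAdj : ∀ {n m} → Graph n → Graph m → CVert n m → CVert n m → Bool
coronaAdj G H (inj₁ i) (inj₁ j) = G i j
coronaAdj G H (inj₁ i) (inj₂ (k , _)) = does (i ≟ k)
coronaAdj G H (inj₂ (k , _)) (inj₁ j) = does (k ≟ j)
coronaAdj G H (inj₂ (k , a)) (inj₂ (l , b)) = does (k ≟ l) ∧ H a b

_⊙_ : ∀ {n m} → Graph n → Graph m → Graph (n + n * m)
_⊙_ {n} {m} G H x y = coronaAdj G H (view n m x) (view n m y)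

-- Cut V(G ⊙ H) into the n blocks {g} ∪ Hᵍ, one per vertex g of G; a vertex of
-- the copy Hᵍ only sees g and Hᵍ.  Let D be super dominating.  If g ∉ D then Hᵍ ⊆ D,
-- since a dominator of a vertex of Hᵍ outside D would also see g.  If g ∈ D and at
-- least two vertices of Hᵍ lie outside D, then g dominates nothing in Hᵍ, so D ∩ Hᵍ
-- is super dominating in H.  Either way the block carries at least
-- min(m, γ_sp(H) + 1) vertices of D.  This minimum is γ_sp(H) + 1 when H has an
-- edge (deleting an endpoint of an edge from V(H) leaves a super dominating set)
-- and m when H = N_m (only V(N_m) is super dominating).  The bound is attained by
-- V(G) plus a minimum set in every copy, respectively by all vertices of the copies.
module Submission where

open import Defs
open import Data.Nat using (ℕ; zero; suc; _+_; _*_; _≤_; _<_; _⊓_; z≤n; s≤s; _≤?_)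
open import Data.Product using (_×_; ∃₂; _,_; proj₁; proj₂)

open import Data.Nat.Properties
  using (≤-trans; ≤-reflexive; +-mono-≤; +-assoc; +-comm; *-suc; n≤1+n;
         m⊓n≤m; m⊓n≤n; m≥n⇒m⊓n≡n; m≤n⇒m⊓n≡m; +-commutativeSemigroup; module ≤-Reasoning)
open import Algebra.Properties.CommutativeSemigroup +-commutativeSemigroup using (x∙yz≈y∙xz)
open import Data.Bool using (false; T)
open import Data.Bool.Properties using (T-∧)
open import Data.Empty using (⊥-elim)
open import Data.Fin using (Fin; zero; suc; splitAt; combine; remQuot; _↑ˡ_; _↑ʳ_)
open import Data.Fin.Properties
  using (_≟_; suc-injective; ↑ʳ-injective; splitAt-↑ˡ; splitAt-↑ʳ; splitAt⁻¹-↑ˡ; splitAt⁻¹-↑ʳ;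
         remQuot-combine; combine-remQuot; combine-injectiveʳ)
open import Data.Fin.Subset using (Subset; inside; outside; _∈_; _∉_; ∣_∣; ⊤; ⊥; _-_)
open import Data.Fin.Subset.Properties
  using (_∈?_; ∈⊤; ⊆⊤; ⊆-antisym; ∣⊤∣≡n; ∣⊥∣≡0; ∣p∣≤∣x∷p∣; drop-there;
         x∈p∧x≢y⇒x∈p-y; x∈p⇒∣p-x∣<∣p∣)
open import Data.Sum using (inj₁; inj₂)
open import Data.Vec using (Vec; []; _∷_; _++_; concat; lookup; replicate; here)
import Data.Vec as Vec
open import Data.Vec.Properties
  using (lookup-++ˡ; lookup-++ʳ; lookup-concat; lookup-replicate; []=⇒lookup; lookup⇒[]=)
open import Function using (_∘_; id; _⇔_; mk⇔)
open import Function.Bundles using (module Equivalence)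
open import Relation.Nullary using (¬_; Dec; yes; no; does)
open import Relation.Nullary.Decidable using (decidable-stable)
open import Relation.Binary.PropositionalEquality
  using (_≡_; _≢_; refl; sym; trans; cong; cong₂; subst; module ≡-Reasoning)

open Equivalence using (to; from)

private
  variable
    k l n m r : ℕ

T-does⇔ : ∀ {A : Set} (a? : Dec A) → T (does a?) ⇔ A
T-does⇔ (yes a) = mk⇔ (λ _ → a) _
T-does⇔ (no ¬a) = mk⇔ (λ ()) ¬a

∈-resp-lookup : ∀ {p : Subset k} {q : Subset l} {x y} → lookup p x ≡ lookup q y → x ∈ p → y ∈ q
∈-resp-lookup {q = q} {y = y} eq x∈p = lookup⇒[]= y q (trans (sym eq) ([]=⇒lookup x∈p))

∈⇔-resp-lookup : ∀ {p : Subset k} {q : Subset l} {x y} → lookup p x ≡ lookup q y → x ∈ p ⇔ y ∈ q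
∈⇔-resp-lookup eq = mk⇔ (∈-resp-lookup eq) (∈-resp-lookup (sym eq))

lookup≡outside⇒∉ : ∀ {p : Subset k} {x} → lookup p x ≡ outside → x ∉ p
lookup≡outside⇒∉ eq x∈p with trans (sym eq) ([]=⇒lookup x∈p)
... | ()

∣p++q∣≡∣p∣+∣q∣ : (p : Subset k) (q : Subset l) → ∣ p ++ q ∣ ≡ ∣ p ∣ + ∣ q ∣
∣p++q∣≡∣p∣+∣q∣ []            q = refl
∣p++q∣≡∣p∣+∣q∣ (outside ∷ p) q = ∣p++q∣≡∣p∣+∣q∣ p q
∣p++q∣≡∣p∣+∣q∣ (inside  ∷ p) q = cong suc (∣p++q∣≡∣p∣+∣q∣ p q)

∣concat-replicate∣ : ∀ n (p : Subset k) → ∣ concat (replicate n p) ∣ ≡ n * ∣ p ∣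
∣concat-replicate∣ zero    p = refl
∣concat-replicate∣ (suc n) p =
  trans (∣p++q∣≡∣p∣+∣q∣ p _) (cong (∣ p ∣ +_) (∣concat-replicate∣ n p))

∀x∈p⇒n≤∣p∣ : {p : Subset n} → (∀ x → x ∈ p) → n ≤ ∣ p ∣
∀x∈p⇒n≤∣p∣ {n} ∀x∈p =
  ≤-reflexive (trans (sym (∣⊤∣≡n n)) (cong ∣_∣ (⊆-antisym (λ {x} _ → ∀x∈p x) ⊆⊤)))

∀x≢y∈p⇒n≤1+∣p∣ : {y : Fin n} (p : Subset n) → (∀ x → x ≢ y → x ∈ p) → n ≤ suc ∣ p ∣
∀x≢y∈p⇒n≤1+∣p∣ {y = zero} (b ∷ p) ∀x≢y∈p =
  s≤s (≤-trans (∀x∈p⇒n≤∣p∣ (λ x → drop-there (∀x≢y∈p (suc x) (λ ())))) (∣p∣≤∣x∷p∣ b p))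
∀x≢y∈p⇒n≤1+∣p∣ {y = suc y} (b ∷ p) ∀x≢y∈p with ∀x≢y∈p zero (λ ())
... | here = s≤s (∀x≢y∈p⇒n≤1+∣p∣ p λ x x≢y → drop-there (∀x≢y∈p (suc x) (x≢y ∘ suc-injective)))

x∉⊤-y⇒x≡y : {x y : Fin n} → x ∉ ⊤ - y → x ≡ y
x∉⊤-y⇒x≡y {x = x} {y} x∉ = decidable-stable (x ≟ y) (x∉ ∘ x∈p∧x≢y⇒x∈p-y ∈⊤)

loopless-⊤-endpoint-superDominating : ∀ {H : Graph m} → (∀ u → H u u ≡ false) →
  ∀ {a b} → Adj H a b → IsSuperDominating H (⊤ - b)
loopless-⊤-endpoint-superDominating loopless {a} {b} a~b u u∉ with x∉⊤-y⇒x≡y u∉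
... | refl = a , x∈p∧x≢y⇒x∈p-y ∈⊤ a≢b , a~b , λ w w∉ _ → x∉⊤-y⇒x≡y w∉
  where
  a≢b : a ≢ b
  a≢b refl = subst T (loopless b) a~b

superDomination-bound<order : ∀ {H : Graph m} {h} → (∀ u → H u u ≡ false) → Nonempty H →
  (∀ D → IsSuperDominating H D → h ≤ ∣ D ∣) → h < m
superDomination-bound<order {m} loopless (a , b , a~b) minimal = begin-strict
  _          ≤⟨ minimal _ (loopless-⊤-endpoint-superDominating loopless a~b) ⟩
  ∣ ⊤ - b ∣  <⟨ x∈p⇒∣p-x∣<∣p∣ (∈⊤ {x = b}) ⟩
  ∣ ⊤ {m} ∣  ≡⟨ ∣⊤∣≡n m ⟩
  m          ∎
  where open ≤-Reasoning

edgeless-superDominating⇒∀x∈p : ∀ {D} → IsSuperDominating (N r) D → ∀ x → x ∈ D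
edgeless-superDominating⇒∀x∈p {D = D} sd x with x ∈? D
... | yes x∈D = x∈D
... | no  x∉D with sd x x∉D
... | _ , _ , () , _

blocks : Subset n → Vec (Subset m) n → Subset (n + n * m)
blocks xs xss = xs ++ concat xss

blocks-surjective : (D : Subset (n + n * m)) → ∃₂ λ xs xss → D ≡ blocks xs xss
blocks-surjective {n} {m} D with Vec.splitAt n D
... | xs , ys , refl with Vec.group n m ys
... | xss , refl = xs , xss , refl

-- The block x ∷ p is not contiguous in the vertex order: p only comes after xs.
∣blocks-∷∣ : ∀ x (xs : Subset n) (p : Subset m) xss →
  ∣ blocks (x ∷ xs) (p ∷ xss) ∣ ≡ ∣ x ∷ p ∣ + ∣ blocks xs xss ∣
∣blocks-∷∣ {n} {m} x xs p xss = begin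
  ∣ [x] ++ xs ++ p ++ c ∣               ≡⟨ ∣p++q∣≡∣p∣+∣q∣ [x] (xs ++ p ++ c) ⟩
  ∣ [x] ∣ + ∣ xs ++ p ++ c ∣            ≡⟨ cong (∣ [x] ∣ +_) (∣p++q∣≡∣p∣+∣q∣ xs (p ++ c)) ⟩
  ∣ [x] ∣ + (∣ xs ∣ + ∣ p ++ c ∣)       ≡⟨ cong (λ t → ∣ [x] ∣ + (∣ xs ∣ + t)) (∣p++q∣≡∣p∣+∣q∣ p c) ⟩
  ∣ [x] ∣ + (∣ xs ∣ + (∣ p ∣ + ∣ c ∣))  ≡⟨ cong (∣ [x] ∣ +_) (x∙yz≈y∙xz (∣ xs ∣) (∣ p ∣) (∣ c ∣)) ⟩
  ∣ [x] ∣ + (∣ p ∣ + (∣ xs ∣ + ∣ c ∣))  ≡⟨ cong (λ t → ∣ [x] ∣ + (∣ p ∣ + t)) (∣p++q∣≡∣p∣+∣q∣ xs c) ⟨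
  ∣ [x] ∣ + (∣ p ∣ + ∣ xs ++ c ∣)       ≡⟨ +-assoc (∣ [x] ∣) (∣ p ∣) (∣ xs ++ c ∣) ⟨
  ∣ [x] ∣ + ∣ p ∣ + ∣ xs ++ c ∣         ≡⟨ cong (_+ ∣ xs ++ c ∣) (∣p++q∣≡∣p∣+∣q∣ [x] p) ⟨
  ∣ x ∷ p ∣ + ∣ blocks xs xss ∣         ∎
  where
  open ≡-Reasoning
  [x] : Subset 1
  [x] = x ∷ []
  c : Subset (n * m)
  c = concat xss

n*k≤∣blocks∣ : ∀ {k} (xs : Subset n) (xss : Vec (Subset m) n) →
  (∀ i → k ≤ ∣ lookup xs i ∷ lookup xss i ∣) → n * k ≤ ∣ blocks xs xss ∣
n*k≤∣blocks∣ []       []         _     = z≤n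
n*k≤∣blocks∣ (x ∷ xs) (p ∷ xss) bound =
  ≤-trans (+-mono-≤ (bound zero) (n*k≤∣blocks∣ xs xss (bound ∘ suc)))
          (≤-reflexive (sym (∣blocks-∷∣ x xs p xss)))

∣blocks-replicate∣ : (xs : Subset n) (p : Subset m) →
  ∣ blocks xs (replicate n p) ∣ ≡ ∣ xs ∣ + n * ∣ p ∣
∣blocks-replicate∣ {n} xs p =
  trans (∣p++q∣≡∣p∣+∣q∣ xs _) (cong (∣ xs ∣ +_) (∣concat-replicate∣ n p))

module Corona {n m} (G : Graph n) (H : Graph m) where

  vG : Fin n → Fin (n + n * m)
  vG i = i ↑ˡ n * m

  vH : Fin n → Fin m → Fin (n + n * m)
  vH i a = n ↑ʳ combine i a

  view-vG : ∀ i → view n m (vG i) ≡ inj₁ i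
  view-vG i rewrite splitAt-↑ˡ n i (n * m) = refl

  view-vH : ∀ i a → view n m (vH i a) ≡ inj₂ (i , a)
  view-vH i a rewrite splitAt-↑ʳ n (n * m) (combine i a) | remQuot-combine {n} {m} i a = refl

  data Vertex : Fin (n + n * m) → Set where
    inG : ∀ i → Vertex (vG i)
    inH : ∀ i a → Vertex (vH i a)

  vertex : ∀ x → Vertex x
  vertex x with splitAt n x in eq
  ... | inj₁ i = subst Vertex (splitAt⁻¹-↑ˡ eq) (inG i)
  ... | inj₂ y = subst Vertex (trans (cong (n ↑ʳ_) (combine-remQuot {n} m y)) (splitAt⁻¹-↑ʳ eq))
                       (inH (proj₁ (remQuot {n} m y)) (proj₂ (remQuot {n} m y)))

  vG≢vH : ∀ {i j a} → vG i ≢ vH j a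
  vG≢vH {i} {j} {a} eq with trans (sym (view-vG i)) (trans (cong (view n m) eq) (view-vH j a))
  ... | ()

  vH-injective : ∀ {i a b} → vH i a ≡ vH i b → a ≡ b
  vH-injective {i} {a} {b} = combine-injectiveʳ i a i b ∘ ↑ʳ-injective n _ _

  Adj⇔coronaAdj : ∀ {x y c d} → view n m x ≡ c → view n m y ≡ d →
    Adj (G ⊙ H) x y ⇔ T (coronaAdj G H c d)
  Adj⇔coronaAdj refl refl = mk⇔ id id

  vG-vH-adj : ∀ {i j a} → Adj (G ⊙ H) (vG i) (vH j a) → i ≡ j
  vG-vH-adj {i} {j} {a} = to (T-does⇔ (i ≟ j)) ∘ to (Adj⇔coronaAdj (view-vG i) (view-vH j a))

  vH-vG-adj : ∀ {i j a} → Adj (G ⊙ H) (vH j a) (vG i) → j ≡ i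
  vH-vG-adj {i} {j} {a} = to (T-does⇔ (j ≟ i)) ∘ to (Adj⇔coronaAdj (view-vH j a) (view-vG i))

  vH-vH-adj : ∀ {i j a b} → Adj (G ⊙ H) (vH i a) (vH j b) → i ≡ j × Adj H a b
  vH-vH-adj {i} {j} {a} {b} adj with to T-∧ (to (Adj⇔coronaAdj (view-vH i a) (view-vH j b)) adj)
  ... | i≟j , a~b = to (T-does⇔ (i ≟ j)) i≟j , a~b

  vG-vH-adj⁺ : ∀ {i a} → Adj (G ⊙ H) (vG i) (vH i a)
  vG-vH-adj⁺ {i} {a} = from (Adj⇔coronaAdj (view-vG i) (view-vH i a)) (from (T-does⇔ (i ≟ i)) refl)

  vH-vG-adj⁺ : ∀ {i a} → Adj (G ⊙ H) (vH i a) (vG i)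
  vH-vG-adj⁺ {i} {a} = from (Adj⇔coronaAdj (view-vH i a) (view-vG i)) (from (T-does⇔ (i ≟ i)) refl)

  vH-vH-adj⁺ : ∀ {i a b} → Adj H a b → Adj (G ⊙ H) (vH i a) (vH i b)
  vH-vH-adj⁺ {i} {a} {b} a~b =
    from (Adj⇔coronaAdj (view-vH i a) (view-vH i b)) (from T-∧ (from (T-does⇔ (i ≟ i)) refl , a~b))

  lookup-blocks-vG : ∀ xs xss i → lookup (blocks xs xss) (vG i) ≡ lookup xs i
  lookup-blocks-vG xs xss i = lookup-++ˡ xs (concat xss) i

  lookup-blocks-vH : ∀ xs xss i a → lookup (blocks xs xss) (vH i a) ≡ lookup (lookup xss i) a
  lookup-blocks-vH xs xss i a = trans (lookup-++ʳ xs (concat xss) (combine i a)) (lookup-concat xss i a)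

  vG∈blocks⇔ : ∀ xs xss {i} → vG i ∈ blocks xs xss ⇔ i ∈ xs
  vG∈blocks⇔ xs xss {i} = ∈⇔-resp-lookup (lookup-blocks-vG xs xss i)

  vH∈blocks⇔ : ∀ xs xss {i a} → vH i a ∈ blocks xs xss ⇔ a ∈ lookup xss i
  vH∈blocks⇔ xs xss {i} {a} = ∈⇔-resp-lookup (lookup-blocks-vH xs xss i a)

  vH∈blocks-replicate⇔ : ∀ xs p {i a} → vH i a ∈ blocks xs (replicate n p) ⇔ a ∈ p
  vH∈blocks-replicate⇔ xs p {i} {a} =
    ∈⇔-resp-lookup (trans (lookup-blocks-vH xs (replicate n p) i a)
                          (cong (λ q → lookup q a) (lookup-replicate i p)))

  module _ (xs : Subset n) (xss : Vec (Subset m) n)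
           (sd : IsSuperDominating (G ⊙ H) (blocks xs xss)) where

    vG∉⇒copy-full : ∀ {i} → vG i ∉ blocks xs xss → ∀ a → a ∈ lookup xss i
    vG∉⇒copy-full {i} vG∉ a with a ∈? lookup xss i
    ... | yes a∈ = a∈
    ... | no  a∉ with sd (vH i a) (a∉ ∘ to (vH∈blocks⇔ xs xss))
    ... | v , v∈ , v~ , unique with vertex v
    ... | inG j with refl ← vG-vH-adj v~ = ⊥-elim (vG∉ v∈)
    ... | inH j b with refl ← proj₁ (vH-vH-adj v~) =
      ⊥-elim (vG≢vH (unique (vG i) vG∉ vH-vG-adj⁺))

    vG-dominates⇒copy-almost-full : ∀ {i u} →
      (∀ w → w ∉ blocks xs xss → Adj (G ⊙ H) (vG i) w → w ≡ vH i u) →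
      ∀ a → a ≢ u → a ∈ lookup xss i
    vG-dominates⇒copy-almost-full {i} unique a a≢u =
      decidable-stable (a ∈? lookup xss i) λ a∉ → a≢u (vH-injective (unique (vH i a) (a∉ ∘ to (vH∈blocks⇔ xs xss)) vG-vH-adj⁺))

    copy-superDominating : ∀ {i} → ¬ (m ≤ suc ∣ lookup xss i ∣) →
      IsSuperDominating H (lookup xss i)
    copy-superDominating {i} large u u∉ with sd (vH i u) (u∉ ∘ to (vH∈blocks⇔ xs xss))
    ... | v , v∈ , v~ , unique with vertex v
    ... | inG j with refl ← vG-vH-adj v~ =
      ⊥-elim (large (∀x≢y∈p⇒n≤1+∣p∣ _ (vG-dominates⇒copy-almost-full unique)))
    ... | inH j b with vH-vH-adj v~
    ... | refl , b~u = b , to (vH∈blocks⇔ xs xss) v∈ , b~u , λ w w∉ b~w →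
      vH-injective (unique (vH i w) (w∉ ∘ to (vH∈blocks⇔ xs xss)) (vH-vH-adj⁺ b~w))

    block-bound : ∀ {h} → (∀ D → IsSuperDominating H D → h ≤ ∣ D ∣) →
      ∀ i → m ⊓ suc h ≤ ∣ lookup xs i ∷ lookup xss i ∣
    block-bound minimal i with lookup xs i in eq
    ... | outside = ≤-trans (m⊓n≤m m _)
      (∀x∈p⇒n≤∣p∣ (vG∉⇒copy-full (lookup≡outside⇒∉ eq ∘ to (vG∈blocks⇔ xs xss))))
    ... | inside with m ≤? suc ∣ lookup xss i ∣
    ... | yes small = ≤-trans (m⊓n≤m m _) small
    ... | no  large = ≤-trans (m⊓n≤n m _) (s≤s (minimal _ (copy-superDominating large)))

  superDominating-lower : ∀ {h D} → (∀ D′ → IsSuperDominating H D′ → h ≤ ∣ D′ ∣) →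
    IsSuperDominating (G ⊙ H) D → n * (m ⊓ suc h) ≤ ∣ D ∣
  superDominating-lower {D = D} minimal sd with blocks-surjective {n} {m} D
  ... | xs , xss , refl = n*k≤∣blocks∣ xs xss (block-bound xs xss sd minimal)

  vG∈blocks-⊤ : ∀ {xss i} → vG i ∈ blocks ⊤ xss
  vG∈blocks-⊤ {xss} = from (vG∈blocks⇔ ⊤ xss) ∈⊤

  vH∈blocks-replicate-⊤ : ∀ {xs i a} → vH i a ∈ blocks xs (replicate n ⊤)
  vH∈blocks-replicate-⊤ {xs} = from (vH∈blocks-replicate⇔ xs ⊤) ∈⊤

  blocks-⊤-superDominating : ∀ {DH} → IsSuperDominating H DH →
    IsSuperDominating (G ⊙ H) (blocks ⊤ (replicate n DH))
  blocks-⊤-superDominating {DH} sdH x x∉ with vertex x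
  ... | inG i = ⊥-elim (x∉ (vG∈blocks-⊤ {replicate n DH}))
  ... | inH i a with sdH a (x∉ ∘ from (vH∈blocks-replicate⇔ ⊤ DH))
  ... | b , b∈ , b~a , unique =
    vH i b , from (vH∈blocks-replicate⇔ ⊤ DH) b∈ , vH-vH-adj⁺ b~a , unique′
    where
    unique′ : ∀ w → w ∉ blocks ⊤ (replicate n DH) → Adj (G ⊙ H) (vH i b) w → w ≡ vH i a
    unique′ w w∉ b~w with vertex w
    ... | inG j = ⊥-elim (w∉ (vG∈blocks-⊤ {replicate n DH}))
    ... | inH j c with vH-vH-adj b~w
    ... | refl , b~c = cong (vH i) (unique c (w∉ ∘ from (vH∈blocks-replicate⇔ ⊤ DH)) b~c)

  blocks-⊥-⊤-superDominating : Fin m → IsSuperDominating (G ⊙ H) (blocks ⊥ (replicate n ⊤))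
  blocks-⊥-⊤-superDominating a x x∉ with vertex x
  ... | inH i b = ⊥-elim (x∉ (vH∈blocks-replicate-⊤ {⊥}))
  ... | inG i = vH i a , vH∈blocks-replicate-⊤ {⊥} , vH-vG-adj⁺ , unique
    where
    unique : ∀ w → w ∉ blocks ⊥ (replicate n ⊤) → Adj (G ⊙ H) (vH i a) w → w ≡ vG i
    unique w w∉ a~w with vertex w
    ... | inH j c = ⊥-elim (w∉ (vH∈blocks-replicate-⊤ {⊥}))
    ... | inG j = cong vG (sym (vH-vG-adj a~w))

superDomination-corona-nonempty : ∀ {n m} (G : Graph n) (H : Graph m) →
  IsSimple G → IsSimple H → Nonempty H → ∀ h → IsSuperDominationNumber H h → IsSuperDominationNumber (G ⊙ H) (n * (h + 1))
superDomination-corona-nonempty {n} {m} G H _ (_ , loopless) nonempty h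
                                ((DH , sdH , ∣DH∣≡h) , minimal) =
  (blocks ⊤ (replicate n DH) , blocks-⊤-superDominating sdH , size) ,
  λ D sd → subst (_≤ ∣ D ∣) (cong (n *_) (trans (m≥n⇒m⊓n≡n h<m) (+-comm 1 h)))
                 (superDominating-lower minimal sd)
  where
  open Corona G H
  h<m : h < m
  h<m = superDomination-bound<order loopless nonempty minimal
  size : ∣ blocks ⊤ (replicate n DH) ∣ ≡ n * (h + 1)
  size = begin
    ∣ blocks ⊤ (replicate n DH) ∣  ≡⟨ ∣blocks-replicate∣ (⊤ {n}) DH ⟩
    ∣ ⊤ {n} ∣ + n * ∣ DH ∣         ≡⟨ cong₂ (λ a b → a + n * b) (∣⊤∣≡n n) ∣DH∣≡h ⟩
    n + n * h                      ≡⟨ *-suc n h ⟨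
    n * suc h                      ≡⟨ cong (n *_) (+-comm 1 h) ⟩
    n * (h + 1)                    ∎
    where open ≡-Reasoning

superDomination-corona-edgeless : ∀ {n} (G : Graph n) → IsSimple G → ∀ r → 1 ≤ r →
  IsSuperDominationNumber (G ⊙ N r) (n * r)
superDomination-corona-edgeless {n} G _ (suc r) _ =
  (blocks ⊥ (replicate n ⊤) , blocks-⊥-⊤-superDominating zero , size) ,
  λ D sd → subst (_≤ ∣ D ∣) (cong (n *_) (m≤n⇒m⊓n≡m (n≤1+n (suc r))))
                 (superDominating-lower minimal sd)
  where
  open Corona G (N (suc r))
  minimal : ∀ D → IsSuperDominating (N (suc r)) D → suc r ≤ ∣ D ∣
  minimal D sd = ∀x∈p⇒n≤∣p∣ (edgeless-superDominating⇒∀x∈p sd)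
  size : ∣ blocks ⊥ (replicate n ⊤) ∣ ≡ n * suc r
  size = trans (∣blocks-replicate∣ (⊥ {n}) ⊤)
               (cong₂ (λ a b → a + n * b) (∣⊥∣≡0 n) (∣⊤∣≡n (suc r)))

theorem18 : (∀ {n m} (G : Graph n) (H : Graph m) → IsSimple G → IsSimple H → Nonempty H →
               ∀ h → IsSuperDominationNumber H h →
               IsSuperDominationNumber (G ⊙ H) (n * (h + 1)))
            × (∀ {n} (G : Graph n) → IsSimple G → ∀ r → 1 ≤ r →
               IsSuperDominationNumber (G ⊙ N r) (n * r))
theorem18 = superDomination-corona-nonempty , superDomination-corona-edgeless
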